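{- Suppose that $1/n\ll\varepsilon\ll1$ and $n/4\leq k\leq 3n/4$. Let $C$ be an oriented cycle on $n$ vertices with $\sigma(C)<\varepsilon n$. Then we can write $C$ as $(u_1u_2\dots u_n)$ such that there exist: (i) long runs $P_1,P_2$ such that $P_1$ is a forward path and $d_C(P_1,P_2)=k$; (ii) long runs $P_1',P_2',P_3',P_4'$ such that $d_C(P_i',P_{i+1}')=\lfloor n/4\rfloor$ for $i=1,2,3$.
   Context: Hierarchy notation: $1/n\ll\varepsilon\ll1$ means there are non-decreasing functions $f_0,f_1$ such that the statement holds whenever $\varepsilon\le f_1(1)$ and $1/n\le f_0(\varepsilon)$. An oriented cycle $C=(u_1u_2\dots u_n)$ has each pair $u_i,u_{i+1}$ (indices mod $n$) joined by exactly one edge; this edge is forward if it is $u_iu_{i+1}$ and backward if it is $u_{i+1}u_i$. A sink vertex of $C$ has indegree $2$ in $C$; $\sigma(C)$ is the number of sink vertices. Subpaths of $C$ are taken in the order $u_i,u_{i+1},\dots$; a subpath is forward (backward) if all its edges are forward (backward), and consistently oriented if it is forward or backward. A long run is a consistently oriented subpath of $C$ of length $20$ (length = number of edges). For vertices $u_i,u_j$, $d_C(u_i,u_j)$ is the length of the subpath $(u_iu_{i+1}\dots u_j)$ of $C$; for subpaths $Q,Q'$, $d_C(Q,Q')=d_C(v,v')$ where $v,v'$ are their initial vertices. -}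

module Defs where

open import Data.Bool using (Bool; true; false; not; _∧_; if_then_else_)
open import Data.Nat using (ℕ; zero; suc; _+_; _*_; _∸_; _<_; _≤_; _/_; _%_)
open import Data.Nat.DivMod using (_mod_)
open import Data.Fin using (Fin; toℕ)
open import Data.List using (List; map; allFin)
open import Data.Nat.ListAction using (sum)
open import Data.Sum using (_⊎_)
open import Relation.Binary.PropositionalEquality using (_≡_)
open import Data.Integer using (+_)
import Data.Rational as ℚ

-- An oriented cycle C = (u₀ u₁ … u_{n-1}) on n vertices (indices mod n) is
-- encoded by the orientations of its edges: o i = true iff the edge between
-- u_i and u_{i+1} is the forward edge u_i u_{i+1}; false iff it is u_{i+1} u_i.
Orientation : ℕ → Set
Orientation n = Fin n → Bool

edgeAt : ∀ {n} → Orientation n → ℕ → Bool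
edgeAt {zero}  o i = false
edgeAt {suc n} o i = o (i mod suc n)

-- Re-writing C as (u_s u_{s+1} … u_{s-1}) : rotation by s
rotate : ∀ {n} → Orientation n → ℕ → Orientation n
rotate o s i = edgeAt o (toℕ i + s)

-- Re-writing C as (u_s u_{s-1} … u_{s+1}) : reversed traversal starting at u_s.
-- The new edge i (between u_{s-i}, u_{s-i-1}) is old edge s-i-1, with its
-- forward/backward status flipped.
reflect : ∀ {n} → Orientation n → ℕ → Orientation n
reflect {n} o s i = not (edgeAt o (s + (n ∸ suc (toℕ i))))

-- All the ways of writing the same oriented cycle as (u₁ … u_n):
-- C' is a rewriting of C (rotation, possibly combined with reversal).
data Rewriting {n : ℕ} (o : Orientation n) : Orientation n → Set where
  rot  : (s : ℕ) → Rewriting o (rotate o s)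
  refl : (s : ℕ) → Rewriting o (reflect o s)

-- vertex u_{i+1} is a sink iff edge i is forward and edge i+1 is backward
sinkInd : ∀ {n} → Orientation n → Fin n → ℕ
sinkInd o i = if o i ∧ not (edgeAt o (suc (toℕ i))) then 1 else 0

σ : ∀ {n} → Orientation n → ℕ
σ {n} o = sum (map (sinkInd o) (allFin n))

ForwardRun : ∀ {n} → Orientation n → Fin n → Set
ForwardRun o i = ∀ j → j < 20 → edgeAt o (toℕ i + j) ≡ true

BackwardRun : ∀ {n} → Orientation n → Fin n → Set
BackwardRun o i = ∀ j → j < 20 → edgeAt o (toℕ i + j) ≡ false

-- long run = consistently oriented subpath of length 20 (identified by its
-- initial vertex u_i)
LongRun : ∀ {n} → Orientation n → Fin n → Set
LongRun o i = ForwardRun o i ⊎ BackwardRun o i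

-- d_C(u_i, u_j) = length of the subpath (u_i u_{i+1} … u_j)
dC : (n : ℕ) → Fin n → Fin n → ℕ
dC zero    i j = 0
dC (suc n) i j = (toℕ j + (suc n ∸ toℕ i)) % suc n

ℕ→ℚ : ℕ → ℚ.ℚ
ℕ→ℚ m = (+ m) ℚ./ 1

-- A position that does not start a long run sees a change of orientation
-- among its next 19 edges.  Every change is a sink or a source, and around a
-- cycle sources and sinks are equally many, so there are 2σ(C) changes and at
-- most 38σ(C) positions fail to start a long run.  A union bound over
-- translates of this set gives a position i such that i, i + k and
-- i + (n - k) all start long runs (for (ii): i, i + q, i + 2q, i + 3q with
-- q = ⌊n/4⌋).  If the run at i is forward, rotate it to the front; otherwise
-- reverse the cycle, which makes it forward and carries the run at i + (n - k)
-- to distance k.  Rotation and reversal preserve σ, so (ii) applies to the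
-- rewritten cycle as well.
module Submission where

open import Defs
open import Data.Nat using (ℕ; _+_; _*_; _≤_; _/_)
open import Data.Fin using (Fin)
open import Data.Product using (Σ; _×_; ∃-syntax)
open import Relation.Binary.PropositionalEquality using (_≡_)
open import Data.Rational using (ℚ; 0ℚ) renaming (_<_ to _<ℚ_; _≤_ to _≤ℚ_; _*_ to _*ℚ_)

import Algebra.Properties.CommutativeSemigroup
open import Data.Bool using (Bool; true; false; not; _∧_; _xor_; if_then_else_)
open import Data.Bool.Properties using (not-involutive; ∧-comm)
open import Data.Fin using (toℕ) renaming (zero to fzero; suc to fsuc)
open import Data.Fin.Properties using (toℕ-fromℕ<; toℕ-injective; toℕ<n)
import Data.Integer as ℤ
open import Data.Integer.Properties using (drop‿+<+; pos-*; +◃n≡+n) renaming (*-identityʳ to ℤ-*-identityʳ)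
open import Data.List using (tabulate)
open import Data.List.Properties using (map-tabulate)
open import Data.Nat using (zero; suc; _<_; _∸_; _%_; z≤n; s≤s; z<s; s<s; s<s⁻¹; NonZero)
open import Data.Nat.Coprimality using (1-coprimeTo) renaming (sym to coprime-sym)
open import Data.Nat.DivMod using (_mod_; m%n<n; m%n%n≡m%n; %-distribˡ-+; [m+n]%n≡m%n; [m+kn]%n≡m%n; m<n⇒m%n≡m; m≡m%n+[m/n]*n; m/n<m)
open import Data.Nat.ListAction using (sum)
open import Data.Nat.Properties
open import Data.Nat.Solver using (module +-*-Solver)
open import Data.Product using (_,_)
open import Data.Rational using (mkℚ; NonNegative; toℚᵘ) renaming (_/_ to _/ℚ_)
open import Data.Rational.Properties using (positive⁻¹; normalize-coprime; *-monoʳ-≤-nonNeg; toℚᵘ-mono-<; toℚᵘ-homo-*) renaming (<-≤-trans to <-≤-transℚ)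
import Data.Rational.Unnormalised as ℚᵘ
open import Data.Rational.Unnormalised.Properties using (<-respʳ-≃)
open import Data.Sum using (inj₁; inj₂)
open import Function using (_∘_)
open import Relation.Binary.PropositionalEquality using (refl; sym; trans; cong; cong₂; subst; subst₂; module ≡-Reasoning)

open +-*-Solver using (solve; _:+_; _:=_; con)
open Algebra.Properties.CommutativeSemigroup +-commutativeSemigroup using (interchange; xy∙z≈xz∙y)

-- Finite sums over initial segments of ℕ

∑< : ℕ → (ℕ → ℕ) → ℕ
∑< zero    f = 0
∑< (suc n) f = ∑< n f + f n

syntax ∑< n (λ i → e) = ∑[ i < n ] e

∑-cong : ∀ n {f g} → (∀ i → i < n → f i ≡ g i) → ∑< n f ≡ ∑< n g
∑-cong zero    eq = refl
∑-cong (suc n) eq = cong₂ _+_ (∑-cong n (λ i i<n → eq i (m<n⇒m<1+n i<n))) (eq n ≤-refl)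

∑-+ : ∀ n (f g : ℕ → ℕ) → ∑[ i < n ] (f i + g i) ≡ ∑< n f + ∑< n g
∑-+ zero    f g = refl
∑-+ (suc n) f g = trans (cong (_+ (f n + g n)) (∑-+ n f g)) (interchange (∑< n f) (∑< n g) (f n) (g n))

∑-*ˡ : ∀ n c (f : ℕ → ℕ) → ∑[ i < n ] (c * f i) ≡ c * ∑< n f
∑-*ˡ zero    c f = sym (*-zeroʳ c)
∑-*ˡ (suc n) c f = trans (cong (_+ c * f n) (∑-*ˡ n c f)) (sym (*-distribˡ-+ c (∑< n f) (f n)))

∑-const : ∀ n c → ∑[ i < n ] c ≡ n * c
∑-const zero    c = refl
∑-const (suc n) c = trans (cong (_+ c) (∑-const n c)) (+-comm (n * c) c)

∑-swap : ∀ n m (f : ℕ → ℕ → ℕ) → ∑[ i < n ] ∑[ j < m ] f i j ≡ ∑[ j < m ] ∑[ i < n ] f i j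
∑-swap zero    m f = sym (trans (∑-const m 0) (*-zeroʳ m))
∑-swap (suc n) m f = trans (cong (_+ ∑< m (f n)) (∑-swap n m f)) (sym (∑-+ m (λ j → ∑[ i < n ] f i j) (f n)))

∑-suc : ∀ n (f : ℕ → ℕ) → ∑< (suc n) f ≡ f 0 + ∑[ i < n ] f (suc i)
∑-suc zero    f = +-comm 0 (f 0)
∑-suc (suc n) f = trans (cong (_+ f (suc n)) (∑-suc n f)) (+-assoc (f 0) _ (f (suc n)))

∑-reverse : ∀ n (f : ℕ → ℕ) → ∑[ i < n ] f (n ∸ suc i) ≡ ∑< n f
∑-reverse zero    f = refl
∑-reverse (suc n) f = begin
  ∑[ i < suc n ] f (suc n ∸ suc i) ≡⟨ ∑-suc n _ ⟩
  f n + ∑[ i < n ] f (n ∸ suc i)   ≡⟨ cong (f n +_) (∑-reverse n f) ⟩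
  f n + ∑< n f                     ≡⟨ +-comm (f n) _ ⟩
  ∑< (suc n) f                     ∎
  where open ≡-Reasoning

∑≡0⇒≡0 : ∀ n {f} → ∑< n f ≡ 0 → ∀ i → i < n → f i ≡ 0
∑≡0⇒≡0 (suc n) {f} ∑≡0 i i<1+n with m<1+n⇒m<n∨m≡n i<1+n
... | inj₁ i<n  = ∑≡0⇒≡0 n (m+n≡0⇒m≡0 (∑< n f) ∑≡0) i i<n
... | inj₂ refl = m+n≡0⇒n≡0 (∑< n f) ∑≡0

∑<n⇒∃≡0 : ∀ n (f : ℕ → ℕ) → ∑< n f < n → ∃[ i ] (i < n × f i ≡ 0)
∑<n⇒∃≡0 (suc n) f ∑<1+n with f n in fn≡
... | zero  = n , ≤-refl , fn≡
... | suc _ with ∑<n⇒∃≡0 n f (≤-<-trans (m≤m+n (∑< n f) _)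
                                        (s<s⁻¹ (subst (_< suc n) (+-suc (∑< n f) _) ∑<1+n)))
...   | i , i<n , fi≡0 = i , m<n⇒m<1+n i<n , fi≡0

Periodic : {A : Set} → (ℕ → A) → ℕ → Set
Periodic f n = ∀ i → f (i + n) ≡ f i

∑-rotate₁ : ∀ n {f : ℕ → ℕ} → Periodic f n → ∑[ i < n ] f (suc i) ≡ ∑< n f
∑-rotate₁ n {f} per = +-cancelˡ-≡ (f 0) _ _ (begin
  f 0 + ∑[ i < n ] f (suc i) ≡⟨ ∑-suc n f ⟨
  ∑< n f + f n               ≡⟨ cong (∑< n f +_) (per 0) ⟩
  ∑< n f + f 0               ≡⟨ +-comm (∑< n f) (f 0) ⟩
  f 0 + ∑< n f               ∎)
  where open ≡-Reasoning

∑-shift : ∀ n s {f : ℕ → ℕ} → Periodic f n → ∑[ i < n ] f (s + i) ≡ ∑< n f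
∑-shift n zero    per = refl
∑-shift n (suc s) per = trans (∑-shift n s (per ∘ suc)) (∑-rotate₁ n per)

∑-shifts : ∀ n m (s : ℕ → ℕ) {f : ℕ → ℕ} → Periodic f n →
           ∑[ i < n ] ∑[ j < m ] f (s j + i) ≡ m * ∑< n f
∑-shifts n m s {f} per = begin
  ∑[ i < n ] ∑[ j < m ] f (s j + i) ≡⟨ ∑-swap n m _ ⟩
  ∑[ j < m ] ∑[ i < n ] f (s j + i) ≡⟨ ∑-cong m (λ j _ → ∑-shift n (s j) per) ⟩
  ∑[ j < m ] ∑< n f                 ≡⟨ ∑-const m _ ⟩
  m * ∑< n f                        ∎
  where open ≡-Reasoning

-- Sinks, changes of orientation and long runs of a periodic Boolean sequence

[_] : Bool → ℕ
[ b ] = if b then 1 else 0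

sink : (ℕ → Bool) → ℕ → Bool
sink G i = G i ∧ not (G (suc i))

sinks : (ℕ → Bool) → ℕ → ℕ
sinks G n = ∑[ i < n ] [ sink G i ]

change : (ℕ → Bool) → ℕ → ℕ
change G i = [ G i xor G (suc i) ]

windowChanges : (ℕ → Bool) → ℕ → ℕ
windowChanges G a = ∑[ j < 19 ] change G (j + a)

RunAt : (ℕ → Bool) → ℕ → Bool → Set
RunAt G a b = ∀ j → j < 20 → G (a + j) ≡ b

xor-telescoping : ∀ a b → [ a xor b ] + [ a ] ≡ 2 * [ a ∧ not b ] + [ b ]
xor-telescoping true  true  = refl
xor-telescoping true  false = refl
xor-telescoping false true  = refl
xor-telescoping false false = refl

[xor]≡0⇒≡ : ∀ a b → [ a xor b ] ≡ 0 → a ≡ b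
[xor]≡0⇒≡ true  true  _ = refl
[xor]≡0⇒≡ false false _ = refl

module _ {G : ℕ → Bool} {n : ℕ} (per : Periodic G n) where

  ∑-change : ∑[ i < n ] change G i ≡ 2 * sinks G n
  ∑-change = +-cancelʳ-≡ _ _ _ (begin
    ∑[ i < n ] change G i + ∑[ i < n ] [ G i ]
      ≡⟨ ∑-+ n (change G) _ ⟨
    ∑[ i < n ] (change G i + [ G i ])
      ≡⟨ ∑-cong n (λ i _ → xor-telescoping (G i) (G (suc i))) ⟩
    ∑[ i < n ] (2 * [ sink G i ] + [ G (suc i) ])
      ≡⟨ ∑-+ n _ _ ⟩
    ∑[ i < n ] (2 * [ sink G i ]) + ∑[ i < n ] [ G (suc i) ]
      ≡⟨ cong₂ _+_ (∑-*ˡ n 2 _) (∑-rotate₁ n (λ i → cong [_] (per i))) ⟩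
    2 * sinks G n + ∑[ i < n ] [ G i ] ∎)
    where open ≡-Reasoning

  change-periodic : Periodic (change G) n
  change-periodic i = cong₂ (λ x y → [ x xor y ]) (per i) (per (suc i))

  sink-periodic : Periodic (λ i → [ sink G i ]) n
  sink-periodic i = cong₂ (λ x y → [ x ∧ not y ]) (per i) (per (suc i))

  RunAt-periodic : ∀ {a b} → RunAt G a b → RunAt G (n + a) b
  RunAt-periodic {a} run j j<20 =
    trans (cong G (trans (+-assoc n a j) (+-comm n (a + j)))) (trans (per (a + j)) (run j j<20))

  windowChanges-periodic : Periodic (windowChanges G) n
  windowChanges-periodic a = ∑-cong 19 λ j _ →
    trans (cong (change G) (sym (+-assoc j a n))) (change-periodic (j + a))

  ∑-windowChanges : ∑[ i < n ] windowChanges G i ≡ 38 * sinks G n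
  ∑-windowChanges = begin
    ∑[ i < n ] ∑[ j < 19 ] change G (j + i) ≡⟨ ∑-shifts n 19 (λ j → j) {change G} change-periodic ⟩
    19 * ∑[ i < n ] change G i              ≡⟨ cong (19 *_) ∑-change ⟩
    19 * (2 * sinks G n)                    ≡⟨ *-assoc 19 2 (sinks G n) ⟨
    38 * sinks G n                          ∎
    where open ≡-Reasoning

  ∑-windowChanges-shifts : ∀ m (s : ℕ → ℕ) →
    ∑[ i < n ] ∑[ j < m ] windowChanges G (s j + i) ≡ m * (38 * sinks G n)
  ∑-windowChanges-shifts m s =
    trans (∑-shifts n m s windowChanges-periodic) (cong (m *_) ∑-windowChanges)

windowChanges≡0⇒RunAt : ∀ G a → windowChanges G a ≡ 0 → RunAt G a (G a)
windowChanges≡0⇒RunAt G a quiet j j<20 = trans (cong G (+-comm a j)) (constant j j<20)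
  where
  constant : ∀ j → j < 20 → G (j + a) ≡ G a
  constant zero    _           = refl
  constant (suc j) (s≤s j<19) =
    trans (sym ([xor]≡0⇒≡ (G (j + a)) (G (suc j + a)) (∑≡0⇒≡0 19 {λ j → change G (j + a)} quiet j j<19)))
          (constant j (m<n⇒m<1+n j<19))

runsAtShifts : ∀ {G n} → Periodic G n → ∀ m → m * (38 * sinks G n) < n → (s : ℕ → ℕ) →
               ∃[ i ] (i < n × ∀ j → j < m → RunAt G (s j + i) (G (s j + i)))
runsAtShifts {G} {n} per m sparse s =
  quietRuns (∑<n⇒∃≡0 n _ (subst (_< n) (sym (∑-windowChanges-shifts per m s)) sparse))
  where
  quietRuns : ∃[ i ] (i < n × ∑[ j < m ] windowChanges G (s j + i) ≡ 0) →
              ∃[ i ] (i < n × ∀ j → j < m → RunAt G (s j + i) (G (s j + i)))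
  quietRuns (i , i<n , quiet) = i , i<n , λ j j<m →
    windowChanges≡0⇒RunAt G (s j + i) (∑≡0⇒≡0 m quiet j j<m)

-- Oriented cycles

sum-tabulate : ∀ k (g : Fin k → ℕ) (h : ℕ → ℕ) → (∀ i → g i ≡ h (toℕ i)) → sum (tabulate g) ≡ ∑< k h
sum-tabulate zero    g h eq = refl
sum-tabulate (suc k) g h eq =
  trans (cong₂ _+_ (eq fzero) (sum-tabulate k (g ∘ fsuc) (h ∘ suc) (eq ∘ fsuc))) (sym (∑-suc k h))

[m%n+k]%n≡[m+k]%n : ∀ m k n .{{_ : NonZero n}} → (m % n + k) % n ≡ (m + k) % n
[m%n+k]%n≡[m+k]%n m k n = begin
  (m % n + k) % n         ≡⟨ %-distribˡ-+ (m % n) k n ⟩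
  (m % n % n + k % n) % n ≡⟨ cong (λ r → (r + k % n) % n) (m%n%n≡m%n m n) ⟩
  (m % n + k % n) % n     ≡⟨ %-distribˡ-+ m k n ⟨
  (m + k) % n             ∎
  where open ≡-Reasoning

module _ {m : ℕ} where
  private
    n : ℕ
    n = suc m

  module _ (o : Orientation n) where

    edgeAt-cong-% : ∀ x y → x % n ≡ y % n → edgeAt o x ≡ edgeAt o y
    edgeAt-cong-% x y eq = cong o (toℕ-injective (begin
      toℕ (x mod n) ≡⟨ toℕ-fromℕ< (m%n<n x n) ⟩
      x % n         ≡⟨ eq ⟩
      y % n         ≡⟨ toℕ-fromℕ< (m%n<n y n) ⟨
      toℕ (y mod n) ∎))
      where open ≡-Reasoning

    edgeAt-periodic : Periodic (edgeAt o) n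
    edgeAt-periodic i = edgeAt-cong-% (i + n) i ([m+n]%n≡m%n i n)

    edgeAt-+* : ∀ x k → edgeAt o (x + k * n) ≡ edgeAt o x
    edgeAt-+* x k = edgeAt-cong-% (x + k * n) x ([m+kn]%n≡m%n x k n)

    edgeAt-%+ : ∀ x y → edgeAt o (x % n + y) ≡ edgeAt o (x + y)
    edgeAt-%+ x y = edgeAt-cong-% (x % n + y) (x + y) ([m%n+k]%n≡[m+k]%n x y n)

    edgeAt-toℕ : ∀ i → edgeAt o (toℕ i) ≡ o i
    edgeAt-toℕ i = cong o (toℕ-injective (trans (toℕ-fromℕ< (m%n<n (toℕ i) n)) (m<n⇒m%n≡m (toℕ<n i))))

    σ≡sinks : σ o ≡ sinks (edgeAt o) n
    σ≡sinks = trans (cong sum (map-tabulate (λ i → i) (sinkInd o))) (sum-tabulate n (sinkInd o) _ λ i →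
      cong (λ b → [ b ∧ not (edgeAt o (suc (toℕ i))) ]) (sym (edgeAt-toℕ i)))

    RunAt-mod : ∀ a {b} → RunAt (edgeAt o) a b → RunAt (edgeAt o) (toℕ (a mod n)) b
    RunAt-mod a run j j<20 =
      trans (cong (λ x → edgeAt o (x + j)) (toℕ-fromℕ< (m%n<n a n))) (trans (edgeAt-%+ a j) (run j j<20))

    longRun : ∀ a b → RunAt (edgeAt o) a b → LongRun o (a mod n)
    longRun a true  run = inj₁ (RunAt-mod a run)
    longRun a false run = inj₂ (RunAt-mod a run)

  dC-mod : ∀ {a b d} → b ≡ a + d → d < n → dC n (a mod n) (b mod n) ≡ d
  dC-mod {a} {b} {d} refl d<n = begin
    (toℕ ((a + d) mod n) + (n ∸ toℕ (a mod n))) % n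
      ≡⟨ cong₂ (λ x y → (x + (n ∸ y)) % n) (toℕ-fromℕ< (m%n<n (a + d) n)) (toℕ-fromℕ< (m%n<n a n)) ⟩
    ((a + d) % n + (n ∸ a % n)) % n                 ≡⟨ [m%n+k]%n≡[m+k]%n (a + d) (n ∸ a % n) n ⟩
    (a + d + (n ∸ a % n)) % n                       ≡⟨ cong (_% n) a+d+[n∸r]≡d+[1+q]n ⟩
    (d + suc (a / n) * n) % n                       ≡⟨ [m+kn]%n≡m%n d (suc (a / n)) n ⟩
    d % n                                           ≡⟨ m<n⇒m%n≡m d<n ⟩
    d                                               ∎
    where
    open ≡-Reasoning
    r q : ℕ
    r = a % n
    q = a / n
    a+d+[n∸r]≡d+[1+q]n : a + d + (n ∸ r) ≡ d + suc q * n
    a+d+[n∸r]≡d+[1+q]n = begin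
      a + d + (n ∸ r)           ≡⟨ cong (λ x → x + d + (n ∸ r)) (m≡m%n+[m/n]*n a n) ⟩
      r + q * n + d + (n ∸ r)   ≡⟨ solve 4 (λ r q n′ d → r :+ q :+ d :+ n′ := d :+ (r :+ n′) :+ q)
                                           refl r (q * n) (n ∸ r) d ⟩
      d + (r + (n ∸ r)) + q * n ≡⟨ cong (λ x → d + x + q * n) (m+[n∸m]≡n (<⇒≤ (m%n<n a n))) ⟩
      d + n + q * n             ≡⟨ +-assoc d n (q * n) ⟩
      d + suc q * n             ∎

  module _ (o : Orientation n) where

    edgeAt-rotate : ∀ s x → edgeAt (rotate o s) x ≡ edgeAt o (x + s)
    edgeAt-rotate s x = trans (cong (λ y → edgeAt o (y + s)) (toℕ-fromℕ< (m%n<n x n))) (edgeAt-%+ o x s)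

    σ-rotate : ∀ s → σ (rotate o s) ≡ σ o
    σ-rotate s = begin
      σ (rotate o s)                            ≡⟨ σ≡sinks (rotate o s) ⟩
      ∑[ i < n ] [ sink (edgeAt (rotate o s)) i ] ≡⟨ ∑-cong n (λ i _ → sink-eq i) ⟩
      ∑[ i < n ] [ sink (edgeAt o) (s + i) ]      ≡⟨ ∑-shift n s (sink-periodic (edgeAt-periodic o)) ⟩
      sinks (edgeAt o) n                        ≡⟨ σ≡sinks o ⟨
      σ o                                       ∎
      where
      open ≡-Reasoning
      sink-eq : ∀ i → [ sink (edgeAt (rotate o s)) i ] ≡ [ sink (edgeAt o) (s + i) ]
      sink-eq i = trans (cong₂ (λ x y → [ x ∧ not y ]) (edgeAt-rotate s i) (edgeAt-rotate s (suc i)))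
                        (cong (λ y → [ sink (edgeAt o) y ]) (+-comm i s))

    RunAt-rotate : ∀ s x {b} → RunAt (edgeAt o) (x + s) b → RunAt (edgeAt (rotate o s)) x b
    RunAt-rotate s x run j j<20 =
      trans (edgeAt-rotate s (x + j)) (trans (cong (edgeAt o) (xy∙z≈xz∙y x j s)) (run j j<20))

    edgeAt-reflect : ∀ r x → suc x ≤ r + n → edgeAt (reflect o r) x ≡ not (edgeAt o (r + n ∸ suc x))
    edgeAt-reflect r x x<r+n = cong not (begin
      edgeAt o (r + (n ∸ suc (toℕ (x mod n))))
        ≡⟨ cong (λ y → edgeAt o (r + (n ∸ suc y))) (toℕ-fromℕ< (m%n<n x n)) ⟩
      edgeAt o (r + (n ∸ suc (x % n)))
        ≡⟨ cong (edgeAt o) (+-cancelʳ-≡ (suc (x % n)) _ _ (trans lhs (sym rhs))) ⟩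
      edgeAt o (r + n ∸ suc x + x / n * n)     ≡⟨ edgeAt-+* o (r + n ∸ suc x) (x / n) ⟩
      edgeAt o (r + n ∸ suc x)                 ∎)
      where
      open ≡-Reasoning
      lhs : r + (n ∸ suc (x % n)) + suc (x % n) ≡ r + n
      lhs = trans (+-assoc r _ _) (cong (r +_) (m∸n+n≡m (m%n<n x n)))
      rhs : r + n ∸ suc x + x / n * n + suc (x % n) ≡ r + n
      rhs = begin
        r + n ∸ suc x + x / n * n + suc (x % n) ≡⟨ +-assoc (r + n ∸ suc x) _ _ ⟩
        r + n ∸ suc x + (x / n * n + suc (x % n))
          ≡⟨ cong (r + n ∸ suc x +_) (trans (+-suc _ _) (cong suc (+-comm _ (x % n)))) ⟩
        r + n ∸ suc x + suc (x % n + x / n * n) ≡⟨ cong (λ y → r + n ∸ suc x + suc y) (m≡m%n+[m/n]*n x n) ⟨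
        r + n ∸ suc x + suc x                   ≡⟨ m∸n+n≡m x<r+n ⟩
        r + n                                   ∎

    σ-reflect : ∀ r → 0 < r → σ (reflect o r) ≡ σ o
    σ-reflect (suc c) _ = begin
      σ (reflect o (suc c))                              ≡⟨ σ≡sinks (reflect o (suc c)) ⟩
      ∑[ x < n ] [ sink (edgeAt (reflect o (suc c))) x ] ≡⟨ ∑-cong n sink-eq ⟩
      ∑[ x < n ] [ sink (edgeAt o) (c + (n ∸ suc x)) ]   ≡⟨ ∑-reverse n (λ y → [ sink (edgeAt o) (c + y) ]) ⟩
      ∑[ y < n ] [ sink (edgeAt o) (c + y) ]             ≡⟨ ∑-shift n c (sink-periodic (edgeAt-periodic o)) ⟩
      sinks (edgeAt o) n                                 ≡⟨ σ≡sinks o ⟨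
      σ o                                                ∎
      where
      open ≡-Reasoning
      sink-eq : ∀ x → x < n → [ sink (edgeAt (reflect o (suc c))) x ] ≡ [ sink (edgeAt o) (c + (n ∸ suc x)) ]
      sink-eq x x<n = cong [_] (begin
        edgeAt (reflect o (suc c)) x ∧ not (edgeAt (reflect o (suc c)) (suc x))
          ≡⟨ cong₂ (λ u v → u ∧ not v) (edgeAt-reflect (suc c) x (s≤s (≤-trans (<⇒≤ x<n) (m≤n+m n c))))
                                        (edgeAt-reflect (suc c) (suc x) (s≤s (≤-trans x<n (m≤n+m n c)))) ⟩
        not (edgeAt o (suc c + n ∸ suc x)) ∧ not (not (edgeAt o (c + n ∸ suc x)))
          ≡⟨ cong₂ (λ u v → not (edgeAt o u) ∧ not (not (edgeAt o v)))
                   (+-∸-assoc (suc c) x<n) (+-∸-assoc c x<n) ⟩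
        not (edgeAt o (suc y)) ∧ not (not (edgeAt o y))
          ≡⟨ cong (not (edgeAt o (suc y)) ∧_) (not-involutive (edgeAt o y)) ⟩
        not (edgeAt o (suc y)) ∧ edgeAt o y
          ≡⟨ ∧-comm _ (edgeAt o y) ⟩
        sink (edgeAt o) y ∎)
        where
        y : ℕ
        y = c + (n ∸ suc x)

    RunAt-reflect : ∀ {r x p b} → x + p + 20 ≡ r → RunAt (edgeAt o) p b →
                    RunAt (edgeAt (reflect o r)) x (not b)
    RunAt-reflect {x = x} {p} {b} refl run j (s≤s j≤19) = begin
      edgeAt (reflect o (x + p + 20)) (x + j)
        ≡⟨ edgeAt-reflect (x + p + 20) (x + j) (subst (suc (x + j) ≤_) (sym r+n≡) (m≤m+n _ _)) ⟩
      not (edgeAt o (x + p + 20 + n ∸ suc (x + j)))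
        ≡⟨ cong (λ y → not (edgeAt o (y ∸ suc (x + j)))) r+n≡ ⟩
      not (edgeAt o (suc (x + j) + (p + d + n) ∸ suc (x + j)))
        ≡⟨ cong (not ∘ edgeAt o) (m+n∸m≡n (suc (x + j)) _) ⟩
      not (edgeAt o (p + d + n))
        ≡⟨ cong not (edgeAt-periodic o (p + d)) ⟩
      not (edgeAt o (p + d))
        ≡⟨ cong not (run d (s≤s (m∸n≤m 19 j))) ⟩
      not b ∎
      where
      open ≡-Reasoning
      d : ℕ
      d = 19 ∸ j
      r+n≡ : x + p + 20 + n ≡ suc (x + j) + (p + d + n)
      r+n≡ = begin
        x + p + 20 + n ≡⟨ cong (λ y → x + p + suc y + n) (m+[n∸m]≡n j≤19) ⟨
        x + p + suc (j + d) + n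
          ≡⟨ solve 5 (λ x p j d n′ → x :+ p :+ (con 1 :+ (j :+ d)) :+ n′ := con 1 :+ (x :+ j) :+ (p :+ d :+ n′))
                     refl x p j d n ⟩
        suc (x + j) + (p + d + n) ∎

RunsAtDistance : ∀ {n} → Orientation n → ℕ → Set
RunsAtDistance {n} o k = ∃[ P₁ ] ∃[ P₂ ] (ForwardRun o P₁ × LongRun o P₂ × dC n P₁ P₂ ≡ k)

RunsAtQuarters : ∀ {n} → Orientation n → Set
RunsAtQuarters {n} o = ∃[ Q₁ ] ∃[ Q₂ ] ∃[ Q₃ ] ∃[ Q₄ ]
  (LongRun o Q₁ × LongRun o Q₂ × LongRun o Q₃ × LongRun o Q₄ ×
   dC n Q₁ Q₂ ≡ n / 4 × dC n Q₂ Q₃ ≡ n / 4 × dC n Q₃ Q₄ ≡ n / 4)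

module _ {m : ℕ} where
  private
    n : ℕ
    n = suc m

    offsets : ℕ → ℕ → ℕ
    offsets k 0 = 0
    offsets k 1 = k
    offsets k _ = n ∸ k

  module _ (o : Orientation n) where

    runsAtQuarters : 4 * (38 * σ o) < n → RunsAtQuarters o
    runsAtQuarters sparse =
      quarters (runsAtShifts (edgeAt-periodic o) 4 (subst (λ K → 4 * (38 * K) < n) (σ≡sinks o) sparse)
                             (_* q))
      where
      q : ℕ
      q = n / 4
      quarters : ∃[ i ] (i < n × ∀ j → j < 4 → RunAt (edgeAt o) (j * q + i) (edgeAt o (j * q + i))) →
                 RunsAtQuarters o
      quarters (i , _ , run) = Q 0 , Q 1 , Q 2 , Q 3 ,
                               R 0 z<s , R 1 (s<s z<s) , R 2 (s<s (s<s z<s)) , R 3 (s<s (s<s (s<s z<s))) ,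
                               step 0 , step 1 , step 2
        where
        Q : ℕ → Fin n
        Q j = (j * q + i) mod n
        R : ∀ j → j < 4 → LongRun o (Q j)
        R j j<4 = longRun o (j * q + i) (edgeAt o (j * q + i)) (run j j<4)
        step : ∀ j → dC n (Q j) (Q (suc j)) ≡ q
        step j = dC-mod (trans (+-assoc q (j * q) i) (+-comm q (j * q + i))) (m/n<m n 4 (s<s z<s))

    rotate-runsAtDistance : ∀ {i k b} → k < n → RunAt (edgeAt o) i true → RunAt (edgeAt o) (k + i) b →
                            RunsAtDistance (rotate o i) k
    rotate-runsAtDistance {i} {k} {b} k<n fwd run =
      0 mod n , k mod n , RunAt-mod (rotate o i) 0 (RunAt-rotate o i 0 {true} fwd) ,
      longRun (rotate o i) k b (RunAt-rotate o i k {b} run) , dC-mod {a = 0} {k} {k} refl k<n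

    reflect-runsAtDistance : ∀ {i k b} → k < n → RunAt (edgeAt o) (n + i) false →
                             RunAt (edgeAt o) ((n ∸ k) + i) b → RunsAtDistance (reflect o (n + i + 20)) k
    reflect-runsAtDistance {i} {k} {b} k<n bwd run =
      0 mod n , k mod n , RunAt-mod (reflect o r) 0 (RunAt-reflect o {r} {0} {n + i} {false} refl bwd) ,
      longRun (reflect o r) k (not b) (RunAt-reflect o {r} {k} {n ∸ k + i} {b} k+[n∸k+i]+20≡ run) ,
      dC-mod {a = 0} {k} {k} refl k<n
      where
      r : ℕ
      r = n + i + 20
      k+[n∸k+i]+20≡ : k + (n ∸ k + i) + 20 ≡ n + i + 20
      k+[n∸k+i]+20≡ =
        cong (_+ 20) (trans (sym (+-assoc k (n ∸ k) i)) (cong (_+ i) (m+[n∸m]≡n (<⇒≤ k<n))))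

    runToFront : ∀ {i k b₁ b₂} → k < n → ∀ b → RunAt (edgeAt o) i b →
                 RunAt (edgeAt o) (k + i) b₁ → RunAt (edgeAt o) ((n ∸ k) + i) b₂ →
                 ∃[ o′ ] (Rewriting o o′ × σ o′ ≡ σ o × RunsAtDistance o′ k)
    runToFront {i} {k} {b₁} k<n true  run₀ run₁ _ =
      rotate o i , rot i , σ-rotate o i , rotate-runsAtDistance {i} {k} {b₁} k<n run₀ run₁
    runToFront {i} {k} {_} {b₂} k<n false run₀ _ run₂ =
      reflect o (n + i + 20) , refl (n + i + 20) , σ-reflect o (n + i + 20) z<s ,
      reflect-runsAtDistance {i} {k} {b₂} k<n (RunAt-periodic (edgeAt-periodic o) {i} {false} run₀) run₂

    runsAtDistance : ∀ {k} → k < n → 3 * (38 * σ o) < n →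
                     ∃[ o′ ] (Rewriting o o′ × σ o′ ≡ σ o × RunsAtDistance o′ k)
    runsAtDistance {k} k<n sparse =
      let i , _ , run = runsAtShifts (edgeAt-periodic o) 3
                          (subst (λ K → 3 * (38 * K) < n) (σ≡sinks o) sparse) (offsets k)
      in runToFront k<n (edgeAt o i) (run 0 z<s) (run 1 (s<s z<s)) (run 2 (s<s (s<s z<s)))

  rewritingWithRuns : ∀ (o : Orientation n) {k} → k < n → 4 * (38 * σ o) < n →
                      ∃[ o′ ] (Rewriting o o′ × RunsAtDistance o′ k × RunsAtQuarters o′)
  rewritingWithRuns o k<n sparse =
    let o′ , rw , σo′≡σo , runs = runsAtDistance o k<n (≤-<-trans (*-monoˡ-≤ (38 * σ o) (n≤1+n 3)) sparse)
    in o′ , rw , runs , runsAtQuarters o′ (subst (λ K → 4 * (38 * K) < n) (sym σo′≡σo) sparse)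

-- 152 = 4 · 38: four translates of a set of at most 38σ(C) positions.
ε₀ : ℚ
ε₀ = ℤ.+ 1 /ℚ 152

0<ε₀ : 0ℚ <ℚ ε₀
0<ε₀ = positive⁻¹ ε₀

ℕ→ℚ≡mkℚ : ∀ m → ℕ→ℚ m ≡ mkℚ (ℤ.+ m) 0 (coprime-sym (1-coprimeTo m))
ℕ→ℚ≡mkℚ m = normalize-coprime (coprime-sym (1-coprimeTo m))

ℚᵘ-bound⇒152*< : ∀ {s n} → ℚᵘ.mkℚᵘ (ℤ.+ s) 0 ℚᵘ.< toℚᵘ ε₀ ℚᵘ.* ℚᵘ.mkℚᵘ (ℤ.+ n) 0 → 152 * s < n
ℚᵘ-bound⇒152*< {s} {n} (ℚᵘ.*<* s*152<1*n*1) =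
  subst (_< n) (*-comm s 152) (drop‿+<+ (subst₂ ℤ._<_ (sym (pos-* s 152)) 1*n*1≡n s*152<1*n*1))
  where
  1*n*1≡n : (ℤ.+ 1 ℤ.* ℤ.+ n) ℤ.* ℤ.+ 1 ≡ ℤ.+ n
  1*n*1≡n = trans (ℤ-*-identityʳ _) (trans (+◃n≡+n (n + 0)) (cong ℤ.+_ (+-identityʳ n)))

<ε₀*⇒152*< : ∀ {ε s n} → ε ≤ℚ ε₀ → ℕ→ℚ s <ℚ ε *ℚ ℕ→ℚ n → 152 * s < n
<ε₀*⇒152*< {ε} {s} {n} ε≤ε₀ s<εn =
  ℚᵘ-bound⇒152*< (subst₂ (λ a b → toℚᵘ a ℚᵘ.< toℚᵘ ε₀ ℚᵘ.* toℚᵘ b) (ℕ→ℚ≡mkℚ s) (ℕ→ℚ≡mkℚ n)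
                   (<-respʳ-≃ (toℚᵘ-homo-* ε₀ (ℕ→ℚ n)) (toℚᵘ-mono-< s<ε₀n)))
  where
  instance
    n≥0 : NonNegative (ℕ→ℚ n)
    n≥0 rewrite ℕ→ℚ≡mkℚ n = _
  s<ε₀n : ℕ→ℚ s <ℚ ε₀ *ℚ ℕ→ℚ n
  s<ε₀n = <-≤-transℚ s<εn (*-monoʳ-≤-nonNeg (ℕ→ℚ n) ε≤ε₀)

sparseCycleRuns : ∀ n k → 4 * k ≤ 3 * n → (C : Orientation n) → 152 * σ C < n →
                  ∃[ C′ ] (Rewriting C C′ × RunsAtDistance C′ k × RunsAtQuarters C′)
sparseCycleRuns zero    k _     C ()
sparseCycleRuns (suc m) k 4k≤3n C sparse =
  rewritingWithRuns C k<n (subst (_< suc m) (*-assoc 4 38 (σ C)) sparse)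
  where
  k<n : k < suc m
  k<n = *-cancelˡ-< 4 k (suc m) (≤-<-trans 4k≤3n (m<n+m (3 * suc m) z<s))

proposition5p5 :
    Σ ℚ λ ε₀ → (0ℚ <ℚ ε₀) ×
    Σ (ℚ → ℕ) λ n₀ →
      (∀ ε ε′ → 0ℚ <ℚ ε → ε ≤ℚ ε′ → n₀ ε′ ≤ n₀ ε) ×
      (∀ (ε : ℚ) → 0ℚ <ℚ ε → ε ≤ℚ ε₀ →
       ∀ (n : ℕ) → n₀ ε ≤ n →
       ∀ (k : ℕ) → n ≤ 4 * k → 4 * k ≤ 3 * n →
       ∀ (C : Orientation n) → ℕ→ℚ (σ C) <ℚ (ε *ℚ ℕ→ℚ n) →
       ∃[ C′ ] (Rewriting C C′ ×
         (∃[ P₁ ] ∃[ P₂ ] (ForwardRun C′ P₁ × LongRun C′ P₂ × dC n P₁ P₂ ≡ k)) ×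
         (∃[ Q₁ ] ∃[ Q₂ ] ∃[ Q₃ ] ∃[ Q₄ ]
           (LongRun C′ Q₁ × LongRun C′ Q₂ × LongRun C′ Q₃ × LongRun C′ Q₄ ×
            dC n Q₁ Q₂ ≡ n / 4 × dC n Q₂ Q₃ ≡ n / 4 × dC n Q₃ Q₄ ≡ n / 4))))
proposition5p5 =
  ε₀ , 0<ε₀ , (λ _ → 0) , (λ _ _ _ _ → z≤n) ,
  λ ε _ ε≤ε₀ n _ k _ 4k≤3n C σ<εn → sparseCycleRuns n k 4k≤3n C (<ε₀*⇒152*< {ε} {σ C} {n} ε≤ε₀ σ<εn)
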